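{- Let $(p,R)$ be a mesh pattern with $p\in\mathfrak{S}_k$, and let $i\in[1,k]$ be such that all of the following hold: (1) none of the four squares $(i-1,p(i)-1)$, $(i-1,p(i))$, $(i,p(i)-1)$, $(i,p(i))$ incident to the point $(i,p(i))$ is in $R$; (2) for all $x\in\{0,\dots,k\}$, $(x,p(i)-1)\in R$ if and only if $(x,p(i))\in R$; (3) for all $y\in\{0,\dots,k\}$, if $(i-1,y)\in R$ then $(i,y)\in R$. Then $(p,R)\asymp\big(p,R\cup\{(i,p(i)),(i,p(i)-1)\}\big)$.
   Context: A mesh pattern is a pair $(p,R)$ where $p\in\mathfrak{S}_k$ and $R\subseteq\{0,\dots,k\}^2$, where $(a,b)\in R$ denotes the unit square $[a,a+1]\times[b,b+1]$ in $[0,k+1]^2$. A permutation $w\in\mathfrak{S}_n$ contains $(p,R)$ if there are indices $1\le i_1<\dots<i_k\le n$ with $w(i_1)\cdots w(i_k)$ order isomorphic to $p$ such that, setting $i_0=0$, $i_{k+1}=n+1$, $v_0=0$, $v_{k+1}=n+1$ and $v_b=w(i_{p^{ -1}(b)})$ for $b\in[1,k]$, for every $(a,b)\in R$ the open rectangle $(i_a,i_{a+1})\times(v_b,v_{b+1})$ contains no point $(x,w(x))$. Otherwise $w$ avoids $(p,R)$. Mesh patterns $\pi,\sigma$ are coincident, $\pi\asymp\sigma$, if they are avoided by exactly the same permutations (of all sizes). -}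

module Defs where

-- Conventions: a permutation of [1,n] is a `Permutation′ n` on Fin n
-- (0-based: position x+1 ↦ value (w x)+1).

open import Data.Nat using (ℕ; zero; suc; _+_) renaming (_<_ to _<ℕ_)
open import Data.Fin using (Fin; zero; suc; toℕ; inject₁; _<_; _≟_)
open import Data.Fin.Permutation using (Permutation′; _⟨$⟩ʳ_; _⟨$⟩ˡ_)
open import Data.Bool using (Bool; true; false; _∨_; _∧_)
open import Data.Product using (Σ; _×_; _,_)
open import Relation.Nullary using (¬_)
open import Relation.Nullary.Decidable using (⌊_⌋)
open import Relation.Binary.PropositionalEquality using (_≡_)
open import Function.Bundles using (_⇔_)

record MeshPattern : Set where
  constructor mesh
  field
    k : ℕ
    pat : Permutation′ k
    R : Fin (suc k) → Fin (suc k) → Bool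

open MeshPattern public

ext′ : ∀ {k} → (Fin k → ℕ) → ℕ → Fin (suc k) → ℕ
ext′ {zero} f t zero = t
ext′ {suc k} f t zero = f zero
ext′ {suc k} f t (suc j) = ext′ (λ x → f (suc x)) t j

ext : ∀ {k} → (Fin k → ℕ) → ℕ → Fin (suc (suc k)) → ℕ
ext f t zero = 0
ext f t (suc j) = ext′ f t j

-- An occurrence of (p , R) in w given by the index embedding e
-- (e a is the 0-based position i_{a+1} - 1).
Occurrence : ∀ {n} → Permutation′ n → (π : MeshPattern) → (Fin (k π) → Fin n) → Set
Occurrence {n} w (mesh k p R) e =
  (∀ a b → a < b → e a < e b)
  × (∀ a b → (p ⟨$⟩ʳ a < p ⟨$⟩ʳ b) ⇔ (w ⟨$⟩ʳ e a < w ⟨$⟩ʳ e b))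
  × (∀ a b → R a b ≡ true → ∀ (x : Fin n) →
       ¬ ( (I (inject₁ a) <ℕ suc (toℕ x)) × (suc (toℕ x) <ℕ I (suc a))
         × (V (inject₁ b) <ℕ suc (toℕ (w ⟨$⟩ʳ x))) × (suc (toℕ (w ⟨$⟩ʳ x)) <ℕ V (suc b))))
  where
    -- i_0 = 0, i_a (1-based positions), i_{k+1} = n+1
    I : Fin (suc (suc k)) → ℕ
    I = ext (λ a → suc (toℕ (e a))) (suc n)
    -- v_0 = 0, v_b = w(i_{p^{-1}(b)}), v_{k+1} = n+1
    V : Fin (suc (suc k)) → ℕ
    V = ext (λ b → suc (toℕ (w ⟨$⟩ʳ e (p ⟨$⟩ˡ b)))) (suc n)

Contains : ∀ {n} → Permutation′ n → MeshPattern → Set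
Contains {n} w π = Σ (Fin (k π) → Fin n) (Occurrence w π)

Avoids : ∀ {n} → Permutation′ n → MeshPattern → Set
Avoids w π = ¬ Contains w π

_≍_ : MeshPattern → MeshPattern → Set
π ≍ σ = ∀ (n : ℕ) (w : Permutation′ n) → Avoids w π ⇔ Avoids w σ

addBoxes : ∀ {k} → (Fin (suc k) → Fin (suc k) → Bool)
  → Fin (suc k) → Fin (suc k) → Fin (suc k) → Fin (suc k)
  → Fin (suc k) → Fin (suc k) → Bool
addBoxes R a₁ b₁ a₂ b₂ x y =
  R x y ∨ (⌊ x ≟ a₁ ⌋ ∧ ⌊ y ≟ b₁ ⌋) ∨ (⌊ x ≟ a₂ ⌋ ∧ ⌊ y ≟ b₂ ⌋)

module Submission where

-- Enlarging R can only make (p , R) harder to contain, so one inclusion is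
-- immediate.  For the other, take an occurrence e of (p , R) in w and call
-- the region of e the set of points of w lying strictly right of point i and
-- left of point i+1, with value strictly between the values adjacent to p(i)
-- in the occurrence; it is the union of the boxes (i, p(i)-1), (i, p(i)) and
-- the segment separating them.  If the region is nonempty, moving point i of
-- the occurrence to any point of it gives again an occurrence of (p , R):
-- hypotheses (1)-(3) guarantee that every shaded box stays empty.  Since
-- point i moves strictly to the right this stops, and then the two added
-- boxes are empty, i.e. we found an occurrence of the enlarged pattern.
-- Only the lower-left corner square of hypothesis (1) is needed: the upper
-- left one follows from (2), and the right ones are irrelevant.

open import Defs
open import Data.Nat using (ℕ; suc)
open import Data.Fin using (Fin; inject₁; suc)
open import Data.Fin.Permutation using (Permutation′; _⟨$⟩ʳ_)
open import Data.Bool using (Bool; true; false)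
open import Relation.Binary.PropositionalEquality using (_≡_)

open import Data.Nat using (zero; z≤n; s≤s; s≤s⁻¹; s<s⁻¹; _+_)
  renaming (_<_ to _<ℕ_; _≤_ to _≤ℕ_; _<?_ to _<ℕ?_; _≤?_ to _≤ℕ?_)
open import Data.Nat.Properties
  using (≤-refl; ≤-reflexive; <⇒≤; <-irrefl; <-asym; <-trans; ≤-<-trans; <-≤-trans;
         <⇒≱; ≮⇒≥; m≤n⇒m<n∨m≡n; m<n⇒m<1+n; m≤n+m; +-suc; +-identityʳ; +-monoˡ-≤; module ≤-Reasoning)
  renaming (<-cmp to <ℕ-cmp)
open import Data.Fin using (zero; toℕ; fromℕ<; _<_; _≤_; _≟_)
open import Data.Fin.Properties
  using (toℕ-injective; toℕ<n; toℕ-inject₁; toℕ-fromℕ<; ≤∧≢⇒<; <⇒≢; <-cmp; all?; any?)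
open import Data.Fin.Permutation using (_⟨$⟩ˡ_; inverseˡ; inverseʳ)
open import Data.Vec.Functional using (updateAt)
open import Data.Vec.Functional.Properties using (updateAt-updates; updateAt-minimal)
open import Data.Product using (Σ; _×_; _,_; proj₁; proj₂)
import Data.Product as Product
open import Data.Sum using (_⊎_; inj₁; inj₂)
open import Data.Empty using (⊥-elim)
open import Function using (const; _∘_)
open import Function.Bundles using (_⇔_; mk⇔; Equivalence; Injection)
open import Function.Properties.Inverse using (↔⇒↣)
open import Relation.Nullary using (¬_; Dec; yes; no; contradiction)
open import Relation.Nullary.Decidable using (_×-dec_; _→-dec_)
open import Relation.Binary using (tri<; tri≈; tri>)
open import Relation.Binary.PropositionalEquality
  using (_≢_; refl; sym; trans; cong; subst; subst₂)

Increasing : ∀ {k} → (Fin k → ℕ) → Set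
Increasing f = ∀ a b → a < b → f a <ℕ f b

increasing⇒monotone : ∀ {k} {f : Fin k → ℕ} → Increasing f → ∀ {a b} → a ≤ b → f a ≤ℕ f b
increasing⇒monotone inc {a} {b} a≤b with m≤n⇒m<n∨m≡n a≤b
... | inj₁ a<b = <⇒≤ (inc a b a<b)
... | inj₂ a≡b rewrite toℕ-injective a≡b = ≤-refl

increasing-reflects : ∀ {k} {f : Fin k → ℕ} → Increasing f → ∀ {a b} → f a <ℕ f b → a < b
increasing-reflects inc {a} {b} fa<fb with <-cmp a b
... | tri< a<b _ _ = a<b
... | tri≈ _ refl _ = contradiction fa<fb (<-irrefl refl)
... | tri> _ _ b<a = contradiction fa<fb (<-asym (inc b a b<a))

-- Gap a of f (a ∈ [0,k]) contains z: z lies above f 0, …, f (a-1) and below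
-- f a, …, f (k-1).  Boxes of mesh patterns are products of two gaps.
Gap : ∀ {k} → (Fin k → ℕ) → Fin (suc k) → ℕ → Set
Gap f a z = (∀ c → c < a → f c <ℕ z) × (∀ c → a ≤ c → z <ℕ f c)

gap? : ∀ {k} (f : Fin k → ℕ) a z → Dec (Gap f a z)
gap? f a z = all? (λ c → (toℕ c <ℕ? toℕ a) →-dec (f c <ℕ? z))
       ×-dec all? (λ c → (toℕ a ≤ℕ? toℕ c) →-dec (z <ℕ? f c))

gap-not-entry : ∀ {k} (f : Fin k → ℕ) a c → ¬ Gap f a (f c)
gap-not-entry f a c (below , above) with toℕ c <ℕ? toℕ a
... | yes c<a = <-irrefl refl (below c c<a)
... | no c≮a = <-irrefl refl (above c (≮⇒≥ c≮a))

Around : ∀ {k} → (Fin k → ℕ) → Fin k → ℕ → Set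
Around f j z = (∀ c → c < j → f c <ℕ z) × (∀ c → j < c → z <ℕ f c)

around? : ∀ {k} (f : Fin k → ℕ) j z → Dec (Around f j z)
around? f j z = all? (λ c → (toℕ c <ℕ? toℕ j) →-dec (f c <ℕ? z))
          ×-dec all? (λ c → (toℕ j <ℕ? toℕ c) →-dec (z <ℕ? f c))

gap-inject₁⇒around : ∀ {k} {f : Fin k → ℕ} {j z} → Gap f (inject₁ j) z → Around f j z
gap-inject₁⇒around {j = j} (below , above) =
    (λ c c<j → below c (subst (toℕ c <ℕ_) (sym (toℕ-inject₁ j)) c<j))
  , (λ c j<c → above c (subst (_≤ℕ toℕ c) (sym (toℕ-inject₁ j)) (<⇒≤ j<c)))

gap-suc⇒around : ∀ {k} {f : Fin k → ℕ} {j z} → Gap f (suc j) z → Around f j z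
gap-suc⇒around (below , above) = (λ c c<j → below c (m<n⇒m<1+n c<j)) , above

around-split : ∀ {k} {f : Fin k → ℕ} {j z} → Around f j z
  → Gap f (inject₁ j) z ⊎ z ≡ f j ⊎ Gap f (suc j) z
around-split {f = f} {j} {z} (left , right) with <ℕ-cmp z (f j)
... | tri< z<fj _ _ = inj₁ (below , above)
  where
    below : ∀ c → c < inject₁ j → f c <ℕ z
    below c c<j = left c (subst (toℕ c <ℕ_) (toℕ-inject₁ j) c<j)
    above : ∀ c → inject₁ j ≤ c → z <ℕ f c
    above c j≤c with m≤n⇒m<n∨m≡n (subst (_≤ℕ toℕ c) (toℕ-inject₁ j) j≤c)
    ... | inj₁ j<c = right c j<c
    ... | inj₂ j≡c rewrite toℕ-injective j≡c = z<fj
... | tri≈ _ z≡fj _ = inj₂ (inj₁ z≡fj)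
... | tri> _ _ fj<z = inj₂ (inj₂ (below , right))
  where
    below : ∀ c → c < suc j → f c <ℕ z
    below c c<j+1 with m≤n⇒m<n∨m≡n (s≤s⁻¹ c<j+1)
    ... | inj₁ c<j = left c c<j
    ... | inj₂ c≡j rewrite toℕ-injective c≡j = fj<z

AgreeOff : ∀ {k} → Fin k → (Fin k → ℕ) → (Fin k → ℕ) → Set
AgreeOff j f′ f = ∀ c → c ≢ j → f′ c ≡ f c

-- The neighbours of j do not see entry j.
around-agree : ∀ {k} {f f′ : Fin k → ℕ} {j z} → AgreeOff j f′ f → Around f′ j z → Around f j z
around-agree agree (left , right) =
    (λ c c<j → subst (_<ℕ _) (agree c (<⇒≢ c<j)) (left c c<j))
  , (λ c j<c → subst (_ <ℕ_) (agree c (<⇒≢ j<c ∘ sym)) (right c j<c))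

increasing-update : ∀ {k} {f f′ : Fin k → ℕ} {j} → Increasing f → AgreeOff j f′ f
  → Around f j (f′ j) → Increasing f′
increasing-update {f′ = f′} {j} inc agree (left , right) a b a<b with a ≟ j | b ≟ j
... | yes refl | yes refl = contradiction a<b (<-irrefl refl)
... | yes refl | no b≢j = subst (f′ j <ℕ_) (sym (agree b b≢j)) (right b a<b)
... | no a≢j | yes refl = subst (_<ℕ f′ j) (sym (agree a a≢j)) (left a a<b)
... | no a≢j | no b≢j = subst₂ _<ℕ_ (sym (agree a a≢j)) (sym (agree b b≢j)) (inc a b a<b)

entry-below-gap : ∀ {k} {f f′ : Fin k → ℕ} {j z} → Increasing f → AgreeOff j f′ f
  → (a : Fin (suc k)) → j < a → a ≢ suc j → Gap f′ a z → f j <ℕ z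
entry-below-gap {j = j} inc agree (suc a) j<a a≢j+1 (below , _) =
  <-trans (inc j a j<a′) (subst (_<ℕ _) (agree a a≢j) (below a ≤-refl))
  where
    a≢j : a ≢ j
    a≢j refl = a≢j+1 refl
    j<a′ : j < a
    j<a′ = ≤∧≢⇒< (s≤s⁻¹ j<a) (a≢j ∘ sym)

entry-above-gap : ∀ {k} {f f′ : Fin k → ℕ} {j z} → Increasing f → AgreeOff j f′ f
  → (a : Fin (suc k)) → a < j → Gap f′ a z → z <ℕ f j
entry-above-gap {j = j} inc agree a a<j (_ , above) =
  <-trans (subst (_ <ℕ_) (agree a′ (<⇒≢ a′<j)) (above a′ (≤-reflexive (sym a′≡a))))
          (inc a′ j a′<j)
  where
    a′ : Fin _
    a′ = fromℕ< (<-trans a<j (toℕ<n j))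
    a′≡a : toℕ a′ ≡ toℕ a
    a′≡a = toℕ-fromℕ< (<-trans a<j (toℕ<n j))
    a′<j : a′ < j
    a′<j = subst (_<ℕ toℕ j) (sym a′≡a) a<j

gap-away : ∀ {k} {f f′ : Fin k → ℕ} {j a z} → Increasing f → AgreeOff j f′ f
  → a ≢ inject₁ j → a ≢ suc j → Gap f′ a z → Gap f a z
gap-away {f = f} {j = j} {a} {z} inc agree a≢j a≢j+1 gap@(below , above) = below′ , above′
  where
    below′ : ∀ c → c < a → f c <ℕ z
    below′ c c<a with c ≟ j
    ... | yes refl = entry-below-gap inc agree a c<a a≢j+1 gap
    ... | no c≢j = subst (_<ℕ z) (agree c c≢j) (below c c<a)
    above′ : ∀ c → a ≤ c → z <ℕ f c
    above′ c a≤c with c ≟ j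
    ... | no c≢j = subst (z <ℕ_) (agree c c≢j) (above c a≤c)
    ... | yes refl = entry-above-gap inc agree a a<j gap
      where
        a<j : a < j
        a<j = subst (toℕ a <ℕ_) (toℕ-inject₁ j)
                (≤∧≢⇒< (subst (toℕ a ≤ℕ_) (sym (toℕ-inject₁ j)) a≤c) a≢j)

gap-raised : ∀ {k} {f f′ : Fin k → ℕ} {j z} → AgreeOff j f′ f → f j ≤ℕ f′ j
  → Gap f′ (suc j) z → Gap f (suc j) z
gap-raised {f = f} {j = j} {z} agree fj≤f′j (below , above) = below′ , above′
  where
    below′ : ∀ c → c < suc j → f c <ℕ z
    below′ c c<j+1 with c ≟ j
    ... | yes refl = ≤-<-trans fj≤f′j (below j ≤-refl)
    ... | no c≢j = subst (_<ℕ z) (agree c c≢j) (below c c<j+1)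
    above′ : ∀ c → suc j ≤ c → z <ℕ f c
    above′ c j<c = subst (z <ℕ_) (agree c (<⇒≢ j<c ∘ sym)) (above c j<c)

ext′-inject₁ : ∀ {k} (F : Fin k → ℕ) t (a : Fin k) → ext′ F t (inject₁ a) ≡ F a
ext′-inject₁ {suc k} F t zero = refl
ext′-inject₁ {suc k} F t (suc a) = ext′-inject₁ (F ∘ suc) t a

lower-boundary : ∀ {k} {f : Fin k → ℕ} → Increasing f → ∀ t a z
  → ext (λ c → suc (f c)) t (inject₁ a) <ℕ suc z ⇔ (∀ c → c < a → f c <ℕ z)
lower-boundary inc t zero z = mk⇔ (λ _ _ ()) (λ _ → s≤s z≤n)
lower-boundary {f = f} inc t (suc a) z rewrite ext′-inject₁ (λ c → suc (f c)) t a =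
  mk⇔ (λ fa<z c c<a+1 → ≤-<-trans (increasing⇒monotone inc (s≤s⁻¹ c<a+1)) (s<s⁻¹ fa<z))
      (λ below → s≤s (below a ≤-refl))

-- The upper boundary of gap a lies above z + 1 iff z is below the entries from
-- a on; for the last gap the boundary is n + 1, whence the hypothesis z < n.
upper-boundary : ∀ {k} {f : Fin k → ℕ} → Increasing f → ∀ {n} a z → z <ℕ n
  → suc z <ℕ ext′ (λ c → suc (f c)) (suc n) a ⇔ (∀ c → a ≤ c → z <ℕ f c)
upper-boundary {zero} inc zero z z<n = mk⇔ (λ _ ()) (λ _ → s≤s z<n)
upper-boundary {suc k} inc zero z z<n =
  mk⇔ (λ z<f0 c _ → <-≤-trans (s<s⁻¹ z<f0) (increasing⇒monotone inc z≤n))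
      (λ above → s≤s (above zero z≤n))
upper-boundary {suc k} inc (suc a) z z<n =
  mk⇔ (λ z<b → λ { zero () ; (suc c) a<c → to z<b c (s≤s⁻¹ a<c) })
      (λ above → from (λ c a≤c → above (suc c) (s≤s a≤c)))
  where open Equivalence (upper-boundary (λ b c → inc (suc b) (suc c) ∘ s≤s) a z z<n)

strip⇔gap : ∀ {k} {f : Fin k → ℕ} → Increasing f → ∀ {n} a z → z <ℕ n
  → (ext (λ c → suc (f c)) (suc n) (inject₁ a) <ℕ suc z
      × suc z <ℕ ext (λ c → suc (f c)) (suc n) (suc a))
    ⇔ Gap f a z
strip⇔gap inc a z z<n = mk⇔
  (Product.map (Equivalence.to (lower-boundary inc _ a z)) (Equivalence.to (upper-boundary inc a z z<n)))
  (Product.map (Equivalence.from (lower-boundary inc _ a z)) (Equivalence.from (upper-boundary inc a z z<n)))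

order-iso⇔increasing : ∀ {k} (σ : Permutation′ k) (g : Fin k → ℕ)
  → (∀ a b → (σ ⟨$⟩ʳ a < σ ⟨$⟩ʳ b) ⇔ (g a <ℕ g b)) ⇔ Increasing (g ∘ (σ ⟨$⟩ˡ_))
order-iso⇔increasing σ g = mk⇔ to from
  where
    g-via-σ : ∀ a → g a ≡ g (σ ⟨$⟩ˡ (σ ⟨$⟩ʳ a))
    g-via-σ a = cong g (sym (inverseˡ σ))
    to : (∀ a b → (σ ⟨$⟩ʳ a < σ ⟨$⟩ʳ b) ⇔ (g a <ℕ g b)) → Increasing (g ∘ (σ ⟨$⟩ˡ_))
    to iso a b a<b = Equivalence.to (iso (σ ⟨$⟩ˡ a) (σ ⟨$⟩ˡ b))
      (subst₂ (λ x y → toℕ x <ℕ toℕ y) (sym (inverseʳ σ)) (sym (inverseʳ σ)) a<b)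
    from : Increasing (g ∘ (σ ⟨$⟩ˡ_)) → ∀ a b → (σ ⟨$⟩ʳ a < σ ⟨$⟩ʳ b) ⇔ (g a <ℕ g b)
    from inc a b = mk⇔
      (λ σa<σb → subst₂ _<ℕ_ (sym (g-via-σ a)) (sym (g-via-σ b)) (inc _ _ σa<σb))
      (λ ga<gb → increasing-reflects inc (subst₂ _<ℕ_ (g-via-σ a) (g-via-σ b) ga<gb))

positions : ∀ {k n} → (Fin k → Fin n) → Fin k → ℕ
positions e c = toℕ (e c)

values : ∀ {k n} → Permutation′ k → Permutation′ n → (Fin k → Fin n) → Fin k → ℕ
values p w e b = toℕ (w ⟨$⟩ʳ e (p ⟨$⟩ˡ b))

values-pattern : ∀ {k n} (p : Permutation′ k) (w : Permutation′ n) e c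
  → values p w e (p ⟨$⟩ʳ c) ≡ toℕ (w ⟨$⟩ʳ e c)
values-pattern p w e c = cong (λ d → toℕ (w ⟨$⟩ʳ e d)) (inverseˡ p)

EmptyBoxes : ∀ {k n} → Permutation′ k → Permutation′ n
  → (Fin (suc k) → Fin (suc k) → Bool) → (Fin k → Fin n) → Set
EmptyBoxes {n = n} p w Q e = ∀ a b → Q a b ≡ true → ∀ (z : Fin n)
  → Gap (positions e) a (toℕ z) → ¬ Gap (values p w e) b (toℕ (w ⟨$⟩ʳ z))

record GapOccurrence {k n} (p : Permutation′ k) (w : Permutation′ n)
    (Q : Fin (suc k) → Fin (suc k) → Bool) (e : Fin k → Fin n) : Set where
  field
    positions-increasing : Increasing (positions e)
    values-increasing : Increasing (values p w e)
    boxes-empty : EmptyBoxes p w Q e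

open GapOccurrence

occurrence⇔gapOccurrence : ∀ {k n} {p : Permutation′ k} {w : Permutation′ n} {Q e}
  → Occurrence w (mesh k p Q) e ⇔ GapOccurrence p w Q e
occurrence⇔gapOccurrence {k} {p = p} {w} {Q} {e} = mk⇔ to from
  where
    iso⇔increasing : (∀ a b → (p ⟨$⟩ʳ a < p ⟨$⟩ʳ b) ⇔ (w ⟨$⟩ʳ e a < w ⟨$⟩ʳ e b))
                   ⇔ Increasing (values p w e)
    iso⇔increasing = order-iso⇔increasing p (λ c → toℕ (w ⟨$⟩ʳ e c))
    to : Occurrence w (mesh k p Q) e → GapOccurrence p w Q e
    to (incE , iso , empty) = record
      { positions-increasing = incE
      ; values-increasing = incV
      ; boxes-empty = λ a b q z col row → empty a b q z (Product.assocʳ′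
          ( Equivalence.from (strip⇔gap incE a (toℕ z) (toℕ<n z)) col
          , Equivalence.from (strip⇔gap incV b (toℕ (w ⟨$⟩ʳ z)) (toℕ<n _)) row))
      }
      where
        incV : Increasing (values p w e)
        incV = Equivalence.to iso⇔increasing iso
    from : GapOccurrence p w Q e → Occurrence w (mesh k p Q) e
    from occ = incE , Equivalence.from iso⇔increasing incV , λ a b q z (c₁ , c₂ , r₁ , r₂) →
      boxes-empty occ a b q z
        (Equivalence.to (strip⇔gap incE a (toℕ z) (toℕ<n z)) (c₁ , c₂))
        (Equivalence.to (strip⇔gap incV b (toℕ (w ⟨$⟩ʳ z)) (toℕ<n _)) (r₁ , r₂))
      where
        incE : Increasing (positions e)
        incE = positions-increasing occ
        incV : Increasing (values p w e)
        incV = values-increasing occ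

occurrence-antitone : ∀ {k n} {p : Permutation′ k} {w : Permutation′ n} {Q Q′ e}
  → (∀ a b → Q a b ≡ true → Q′ a b ≡ true)
  → Occurrence w (mesh k p Q′) e → Occurrence w (mesh k p Q) e
occurrence-antitone Q⊆Q′ (incE , iso , empty) = incE , iso , λ a b q → empty a b (Q⊆Q′ a b q)

addBoxes-⊇ : ∀ {k} (Q : Fin (suc k) → Fin (suc k) → Bool) a₁ b₁ a₂ b₂ x y
  → Q x y ≡ true → addBoxes Q a₁ b₁ a₂ b₂ x y ≡ true
addBoxes-⊇ Q a₁ b₁ a₂ b₂ x y q rewrite q = refl

addBoxes-cases : ∀ {k} (Q : Fin (suc k) → Fin (suc k) → Bool) a₁ b₁ a₂ b₂ x y
  → addBoxes Q a₁ b₁ a₂ b₂ x y ≡ true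
  → Q x y ≡ true ⊎ (x ≡ a₁ × y ≡ b₁) ⊎ (x ≡ a₂ × y ≡ b₂)
addBoxes-cases Q a₁ b₁ a₂ b₂ x y q with Q x y | x ≟ a₁ | y ≟ b₁ | x ≟ a₂ | y ≟ b₂
... | true  | _      | _      | _      | _      = inj₁ refl
... | false | yes x₁ | yes y₁ | _      | _      = inj₂ (inj₁ (x₁ , y₁))
... | false | yes _  | no _   | yes x₂ | yes y₂ = inj₂ (inj₂ (x₂ , y₂))
... | false | no _   | _      | yes x₂ | yes y₂ = inj₂ (inj₂ (x₂ , y₂))

permutation-injective : ∀ {n} (π : Permutation′ n) {x y} → π ⟨$⟩ʳ x ≡ π ⟨$⟩ʳ y → x ≡ y
permutation-injective π = Injection.injective (↔⇒↣ π)

module Shift {k n : ℕ} (p : Permutation′ k) (w : Permutation′ n) (i : Fin k) where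

  pᵢ : Fin k
  pᵢ = p ⟨$⟩ʳ i

  shift : (Fin k → Fin n) → Fin n → Fin k → Fin n
  shift e x = updateAt e i (const x)

  Region : (Fin k → Fin n) → Fin n → Set
  Region e x = Gap (positions e) (suc i) (toℕ x) × Around (values p w e) pᵢ (toℕ (w ⟨$⟩ʳ x))

  region? : ∀ e x → Dec (Region e x)
  region? e x = gap? (positions e) (suc i) (toℕ x) ×-dec around? (values p w e) pᵢ (toℕ (w ⟨$⟩ʳ x))

  region-right-of-i : ∀ {e x} → Region e x → toℕ (e i) <ℕ toℕ x
  region-right-of-i ((below , _) , _) = below i ≤-refl

  positions-shift-agree : ∀ e x → AgreeOff i (positions (shift e x)) (positions e)
  positions-shift-agree e x c c≢i = cong toℕ (updateAt-minimal c i e c≢i)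

  positions-shift-at : ∀ e x → positions (shift e x) i ≡ toℕ x
  positions-shift-at e x = cong toℕ (updateAt-updates i e)

  values-shift-agree : ∀ e x → AgreeOff pᵢ (values p w (shift e x)) (values p w e)
  values-shift-agree e x c c≢pᵢ =
    cong (λ d → toℕ (w ⟨$⟩ʳ d)) (updateAt-minimal (p ⟨$⟩ˡ c) i e p⁻¹c≢i)
    where
      p⁻¹c≢i : p ⟨$⟩ˡ c ≢ i
      p⁻¹c≢i eq = c≢pᵢ (trans (sym (inverseʳ p)) (cong (p ⟨$⟩ʳ_) eq))

  values-shift-at : ∀ e x → values p w (shift e x) pᵢ ≡ toℕ (w ⟨$⟩ʳ x)
  values-shift-at e x =
    trans (values-pattern p w (shift e x) i) (cong (λ d → toℕ (w ⟨$⟩ʳ d)) (updateAt-updates i e))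

  Enlarged : (Fin (suc k) → Fin (suc k) → Bool) → Fin (suc k) → Fin (suc k) → Bool
  Enlarged R = addBoxes R (suc i) (suc pᵢ) (suc i) (inject₁ pᵢ)

  -- When the region is empty, an occurrence of (p , R) is one of the enlarged
  -- pattern: a point in either added box would lie in the region.
  no-region⇒enlarged : ∀ {R e} → GapOccurrence p w R e → ¬ Σ (Fin n) (Region e)
    → GapOccurrence p w (Enlarged R) e
  no-region⇒enlarged {R} {e} occ none = record
    { positions-increasing = positions-increasing occ
    ; values-increasing = values-increasing occ
    ; boxes-empty = empty
    }
    where
      empty : EmptyBoxes p w (Enlarged R) e
      empty a b q z col row with addBoxes-cases R (suc i) (suc pᵢ) (suc i) (inject₁ pᵢ) a b q
      ... | inj₁ q′ = boxes-empty occ a b q′ z col row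
      ... | inj₂ (inj₁ (refl , refl)) = none (z , col , gap-suc⇒around row)
      ... | inj₂ (inj₂ (refl , refl)) = none (z , col , gap-inject₁⇒around row)

  module _ (R : Fin (suc k) → Fin (suc k) → Bool)
           (corner-free : R (inject₁ i) (inject₁ pᵢ) ≡ false)
           (rows-alike : ∀ x → R x (inject₁ pᵢ) ≡ R x (suc pᵢ))
           (left⇒right : ∀ y → R (inject₁ i) y ≡ true → R (suc i) y ≡ true) where

    shaded-column : ∀ a → R a (inject₁ pᵢ) ≡ true → a ≢ inject₁ i
    shaded-column a q refl with trans (sym q) corner-free
    ... | ()

    module _ {e : Fin k → Fin n} {x : Fin n}
             (occ : GapOccurrence p w R e) (reg : Region e x) where

      E′ V′ : Fin k → ℕ
      E′ = positions (shift e x)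
      V′ = values p w (shift e x)

      -- Moving point i to the right only shrinks the columns other than the
      -- one left of it.
      column-shrinks : ∀ a {z} → a ≢ inject₁ i → Gap E′ a z → Gap (positions e) a z
      column-shrinks a a≢i col with a ≟ suc i
      ... | yes refl = gap-raised (positions-shift-agree e x)
            (subst (toℕ (e i) ≤ℕ_) (sym (positions-shift-at e x)) (<⇒≤ (region-right-of-i reg))) col
      ... | no a≢i+1 = gap-away (positions-increasing occ) (positions-shift-agree e x) a≢i a≢i+1 col

      -- A point in a shaded box meeting the rows next to p(i) of the moved
      -- occurrence: by (2) both rows are shaded in its column, so it lies in
      -- a shaded box of e, or it is the old point i itself.
      band-empty : ∀ a z → R a (inject₁ pᵢ) ≡ true → R a (suc pᵢ) ≡ true
        → Gap (positions e) a (toℕ z) → ¬ Around V′ pᵢ (toℕ (w ⟨$⟩ʳ z))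
      band-empty a z below-shaded above-shaded col around
        with around-split (around-agree (values-shift-agree e x) around)
      ... | inj₁ below = boxes-empty occ a (inject₁ pᵢ) below-shaded z col below
      ... | inj₂ (inj₁ wz≡) = gap-not-entry (positions e) a (p ⟨$⟩ˡ pᵢ)
            (subst (Gap (positions e) a) (cong toℕ z≡) col)
        where
          z≡ : z ≡ e (p ⟨$⟩ˡ pᵢ)
          z≡ = permutation-injective w (toℕ-injective wz≡)
      ... | inj₂ (inj₂ above) = boxes-empty occ a (suc pᵢ) above-shaded z col above

      -- A point in a shaded box away from the rows next to p(i): the row is
      -- unchanged; the column is too unless it is the one left of point i,
      -- which now also spans the old point i and (by (3)) the shaded column
      -- right of it.
      off-band-empty : ∀ a b z → R a b ≡ true
        → Gap E′ a (toℕ z) → ¬ Gap (values p w e) b (toℕ (w ⟨$⟩ʳ z))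
      off-band-empty a b z q col row with a ≟ inject₁ i
      ... | no a≢i = boxes-empty occ a b q z (column-shrinks a a≢i col) row
      ... | yes refl with around-split (around-agree (positions-shift-agree e x) (gap-inject₁⇒around col))
      ...   | inj₁ left = boxes-empty occ (inject₁ i) b q z left row
      ...   | inj₂ (inj₁ z≡) = gap-not-entry (values p w e) b pᵢ
              (subst (Gap (values p w e) b) wz≡ row)
        where
          wz≡ : toℕ (w ⟨$⟩ʳ z) ≡ values p w e pᵢ
          wz≡ = trans (cong (λ d → toℕ (w ⟨$⟩ʳ d)) (toℕ-injective z≡)) (sym (values-pattern p w e i))
      ...   | inj₂ (inj₂ right) = boxes-empty occ (suc i) b (left⇒right b q) z right row

      shift-occurrence : GapOccurrence p w R (shift e x)
      shift-occurrence = record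
        { positions-increasing = increasing-update (positions-increasing occ) (positions-shift-agree e x)
            (subst (Around (positions e) i) (sym (positions-shift-at e x)) (gap-suc⇒around (proj₁ reg)))
        ; values-increasing = increasing-update (values-increasing occ) (values-shift-agree e x)
            (subst (Around (values p w e) pᵢ) (sym (values-shift-at e x)) (proj₂ reg))
        ; boxes-empty = empty
        }
        where
          empty : EmptyBoxes p w R (shift e x)
          empty a b q z col row with b ≟ inject₁ pᵢ | b ≟ suc pᵢ
          ... | yes refl | _ = band-empty a z q (trans (sym (rows-alike a)) q)
                (column-shrinks a (shaded-column a q) col) (gap-inject₁⇒around row)
          ... | no _ | yes refl = band-empty a z (trans (rows-alike a) q) q
                (column-shrinks a (shaded-column a (trans (rows-alike a) q)) col) (gap-suc⇒around row)
          ... | no b≢ | no b≢′ = off-band-empty a b z q col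
                (gap-away (values-increasing occ) (values-shift-agree e x) b≢ b≢′ row)

    -- Keep moving point i into the region until the region is empty.  Point i
    -- moves strictly right, so n ≤ toℕ (e i) + fuel bounds the number of moves.
    push : ∀ fuel e → n ≤ℕ toℕ (e i) + fuel → GapOccurrence p w R e
      → Σ (Fin k → Fin n) (GapOccurrence p w (Enlarged R))
    push zero e bound _ = ⊥-elim (<⇒≱ (toℕ<n (e i)) (subst (n ≤ℕ_) (+-identityʳ _) bound))
    push (suc fuel) e bound occ with any? (region? e)
    ... | no none = e , no-region⇒enlarged occ none
    ... | yes (x , reg) = push fuel (shift e x) bound′ (shift-occurrence occ reg)
      where
        open ≤-Reasoning
        bound′ : n ≤ℕ toℕ (shift e x i) + fuel
        bound′ = begin
          n                          ≤⟨ bound ⟩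
          toℕ (e i) + suc fuel       ≡⟨ +-suc (toℕ (e i)) fuel ⟩
          suc (toℕ (e i)) + fuel     ≤⟨ +-monoˡ-≤ fuel (region-right-of-i reg) ⟩
          toℕ x + fuel               ≡⟨ cong (_+ fuel) (sym (positions-shift-at e x)) ⟩
          toℕ (shift e x i) + fuel   ∎

corollary7p1 : (k : ℕ) (p : Permutation′ k) (R : Fin (suc k) → Fin (suc k) → Bool) (i : Fin k)
    → R (inject₁ i) (inject₁ (p ⟨$⟩ʳ i)) ≡ false
    → R (inject₁ i) (suc (p ⟨$⟩ʳ i)) ≡ false
    → R (suc i) (inject₁ (p ⟨$⟩ʳ i)) ≡ false
    → R (suc i) (suc (p ⟨$⟩ʳ i)) ≡ false
    → (∀ x → R x (inject₁ (p ⟨$⟩ʳ i)) ≡ R x (suc (p ⟨$⟩ʳ i)))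
    → (∀ y → R (inject₁ i) y ≡ true → R (suc i) y ≡ true)
    → mesh k p R ≍ mesh k p (addBoxes R (suc i) (suc (p ⟨$⟩ʳ i)) (suc i) (inject₁ (p ⟨$⟩ʳ i)))
corollary7p1 k p R i corner-free _ _ _ rows-alike left⇒right n w = mk⇔ fewer⇒more more⇒fewer
  where
    open Shift p w i
    fewer⇒more : Avoids w (mesh k p R) → Avoids w (mesh k p (Enlarged R))
    fewer⇒more avoid (e , occ) = avoid (e , occurrence-antitone {p = p} {w = w} {Q′ = Enlarged R} {e = e}
      (addBoxes-⊇ R (suc i) (suc pᵢ) (suc i) (inject₁ pᵢ)) occ)
    more⇒fewer : Avoids w (mesh k p (Enlarged R)) → Avoids w (mesh k p R)
    more⇒fewer avoid (e , occ) = avoid (Product.map₂ (Equivalence.from occurrence⇔gapOccurrence)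
      (push R corner-free rows-alike left⇒right n e (m≤n+m n (toℕ (e i)))
        (Equivalence.to occurrence⇔gapOccurrence occ)))
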